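{- Let $(G,\pi,P)$ be an online graph with predictions and fix an optimal coloring $O\in\mathcal{O}(G)$. For a predicted color $c_i$, let $\eta_i(G)$ be the number of vertices $v$ with $P(v)=c_i$ for which $O(v)\ne P(v)$, and let $x_i(G)$ be the number of distinct colors that \textsc{FirstFitPredictions} uses on the vertices with $P(v)=c_i$ (i.e., the vertices of color palette $C(i)$). Then $x_i(G)\le \eta_i(G)+1$.
   Context: An online graph with predictions $(G,\pi,P)$ consists of a finite graph $G=(V,E)$, an ordering $\pi$ of $V$ in which vertices are revealed one by one (with adjacencies to earlier vertices), and a map $P:V\to\mathcal{U}$ of predicted colors, revealed with the vertices; $\mathcal{U}$ is an infinite universe of colors. $\mathcal{O}(G)$ is the set of proper colorings $O:V\to\mathcal{U}$ of $G$ using exactly $\chi(G)$ colors. \textsc{FirstFitPredictions}: for each predicted color $c_i$ there is a palette $C(i)=\{c_i^0=c_i,c_i^1,c_i^2,\dots\}$ ordered by superscript, palettes of distinct predicted colors being pairwise disjoint; an arriving vertex $v$ with $P(v)=c_i$ receives the smallest-superscript color of $C(i)$ not assigned to any previously revealed neighbor of $v$. -}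

module Defs where

open import Data.Nat using (ℕ; _≤_; _<_)
open import Data.Nat.Properties using (_≟_)
open import Data.Fin using (Fin)
open import Data.Fin.Permutation using (Permutation′; _⟨$⟩ˡ_)
import Data.Fin as F
open import Data.List using (List; length; map; filter; deduplicate)
open import Data.Fin.Base using () renaming (_<_ to _<ᶠ_)
open import Data.List using ()
open import Data.Fin using () 
open import Data.Product using (_×_)
open import Data.Empty using (⊥)
open import Relation.Nullary using (¬_)
open import Relation.Nullary.Decidable using (_×-dec_; ¬?)
open import Relation.Binary.PropositionalEquality using (_≡_; _≢_)

open import Data.List using () renaming (allFin to vertices) public

Color : Set
Color = ℕ

record Graph (n : ℕ) : Set₁ where
  field
    Adj     : Fin n → Fin n → Set
    symAdj  : ∀ {u v} → Adj u v → Adj v u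
    irrefl  : ∀ {v} → ¬ Adj v v
open Graph public

numColors : ∀ {n} → (Fin n → Color) → ℕ
numColors {n} c = length (deduplicate _≟_ (map c (vertices n)))

Proper : ∀ {n} → Graph n → (Fin n → Color) → Set
Proper G c = ∀ u v → Adj G u v → c u ≢ c v

Optimal : ∀ {n} → Graph n → (Fin n → Color) → Set
Optimal G O = Proper G O × (∀ c → Proper G c → numColors O ≤ numColors c)

-- Ordering π: π ⟨$⟩ʳ i is the i-th revealed vertex; u is revealed before v.
Before : ∀ {n} → Permutation′ n → Fin n → Fin n → Set
Before π u v = (π ⟨$⟩ˡ u) <ᶠ (π ⟨$⟩ˡ v)

-- A vertex v receives colour c_{P v}^{f v}
-- of palette C(P v); we record the superscript f v.  Palettes of distinct
-- predicted colours are disjoint, so only earlier neighbours u with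
-- P u ≡ P v can hold colours of C(P v); colour c_{P v}^k is held by such u
-- iff f u ≡ k.  f is the FirstFitPredictions output iff for every v, f v is
-- the least superscript not held by an earlier neighbour.
IsFirstFitPredictions : ∀ {n} → Graph n → Permutation′ n → (Fin n → Color)
                      → (Fin n → ℕ) → Set
IsFirstFitPredictions G π P f =
  ∀ v →
    (∀ u → Before π u v → Adj G u v → P u ≡ P v → f u ≢ f v)
    × (∀ k → k < f v →
         Data.Product.∃ λ u → Before π u v × Adj G u v × P u ≡ P v × f u ≡ k)

eta : ∀ {n} → (Fin n → Color) → (Fin n → Color) → Color → ℕ
eta {n} P O c =
  length (filter (λ v → (P v ≟ c) ×-dec ¬? (O v ≟ c)) (vertices n))

xcount : ∀ {n} → (Fin n → Color) → (Fin n → ℕ) → Color → ℕ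
xcount {n} P f c =
  length (deduplicate _≟_ (map f (filter (λ v → P v ≟ c) (vertices n))))

-- Fix c and call v mispredicted when P v ≡ c but O v ≢ c.  Every vertex w with
-- P w ≡ c sits on top of at least f w mispredicted vertices with pairwise
-- distinct superscripts: if O w ≡ c, the earlier neighbours forcing w past
-- superscripts 0, …, f w − 1 all have O-colour ≠ c because O is proper; if
-- O w ≢ c, take w itself together with the chain below the neighbour holding
-- superscript f w − 1.  Hence every superscript used in C(c) is at most η,
-- so at most η + 1 colours of C(c) are used.
module Submission where

open import Defs
open import Data.Nat using (ℕ; zero; suc; _≤_; _<_; _+_; s≤s; z≤n)
open import Data.Nat.Properties
  using (_≟_; ≤-refl; ≤-reflexive; ≤-trans; <⇒≤; <-irrefl; <-≤-trans; n≤1+n; +-comm)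
open import Data.Fin using (Fin)
open import Data.Fin.Permutation using (Permutation′)
open import Data.List using (List; []; _∷_; length; map; filter; deduplicate; upTo)
open import Data.List.Properties using (length-removeAt′; length-upTo)
open import Data.List.Membership.Propositional using (_∈_; _─_)
open import Data.List.Membership.Propositional.Properties
  using (∈-filter⁺; ∈-filter⁻; ∈-allFin; ∈-map⁻; ∈-upTo⁺; ∈-deduplicate⁻)
open import Data.List.Relation.Binary.Subset.Propositional using (_⊆_)
open import Data.List.Relation.Unary.Any using (here; there)
open import Data.List.Relation.Unary.All as All using (All; []; _∷_)
open import Data.List.Relation.Unary.AllPairs as AllPairs using (AllPairs; []; _∷_)
open import Data.List.Relation.Unary.Unique.Propositional using (Unique)
open import Data.List.Relation.Unary.Unique.DecPropositional.Properties
  using (deduplicate-!)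
open import Data.Product using (Σ; _×_; _,_; proj₁; proj₂; map₂)
open import Data.Empty using (⊥-elim)
open import Relation.Nullary using (yes; no)
open import Relation.Nullary.Decidable using (_×-dec_; ¬?)
open import Relation.Binary.PropositionalEquality
  using (_≡_; _≢_; refl; sym; trans; cong; subst)

module _ {A : Set} where

  ∈-─ : ∀ {x z : A} {ys : List A} (p : x ∈ ys) → z ∈ ys → z ≢ x → z ∈ ys ─ p
  ∈-─ (here refl) (here refl) z≢x = ⊥-elim (z≢x refl)
  ∈-─ (here refl) (there q)   _   = q
  ∈-─ (there p)   (here z≡y)  _   = here z≡y
  ∈-─ (there p)   (there q)   z≢x = there (∈-─ p q z≢x)

  Unique-⊆⇒length≤ : ∀ {xs ys : List A} → Unique xs → xs ⊆ ys → length xs ≤ length ys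
  Unique-⊆⇒length≤ {[]}     _            _  = z≤n
  Unique-⊆⇒length≤ {x ∷ xs} {ys} (x∉xs ∷ u) xs⊆ys =
    subst (suc (length xs) ≤_) (sym (length-removeAt′ ys _))
      (s≤s (Unique-⊆⇒length≤ u λ z∈xs →
        ∈-─ x∈ys (xs⊆ys (there z∈xs)) λ z≡x → All.lookup x∉xs z∈xs (sym z≡x)))
    where x∈ys = xs⊆ys (here refl)

  Descending : (A → ℕ) → List A → Set
  Descending h = AllPairs (λ u v → h v < h u)

  Descending⇒Unique : ∀ {h : A → ℕ} {xs : List A} → Descending h xs → Unique xs
  Descending⇒Unique {h} = AllPairs.map λ hv<hu u≡v → <-irrefl (cong h (sym u≡v)) hv<hu

module _ {n : ℕ} (G : Graph n) (π : Permutation′ n) (P O : Fin n → Color)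
         (proper : Proper G O) (f : Fin n → ℕ) (firstFit : IsFirstFitPredictions G π P f)
         (c : Color) where

  Mispredicted : Fin n → Set
  Mispredicted v = P v ≡ c × O v ≢ c

  Chain : (b k : ℕ) → Set
  Chain b k = Σ (List (Fin n)) λ L →
    k ≤ length L × Descending f L × All (λ v → Mispredicted v × f v < b) L

  raise-bound : ∀ {b b′ L} → b ≤ b′ →
                All (λ v → Mispredicted v × f v < b) L → All (λ v → Mispredicted v × f v < b′) L
  raise-bound b≤b′ = All.map (map₂ λ fv<b → <-≤-trans fv<b b≤b′)

  superscripts-below : ∀ {b L u} → f u ≡ b →
                       All (λ v → Mispredicted v × f v < b) L → All (λ v → f v < f u) L
  superscripts-below refl = All.map proj₂

  correct⇒chain : ∀ {w} → P w ≡ c → O w ≡ c → ∀ j → j ≤ f w → Chain j j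
  correct⇒chain _ _ zero _ = [] , z≤n , [] , []
  correct⇒chain {w} pw ow (suc j) j<fw
    with correct⇒chain pw ow j (<⇒≤ j<fw) | proj₂ (firstFit w) j j<fw
  ... | L , j≤|L| , desc , bounded | u , _ , u~w , pu , fu≡j =
    u ∷ L , s≤s j≤|L| , superscripts-below fu≡j bounded ∷ desc ,
    ((trans pu pw , λ ou≡c → proper u w u~w (trans ou≡c (sym ow))) , s≤s (≤-reflexive fu≡j))
      ∷ raise-bound (n≤1+n j) bounded

  chain-below : ∀ k w → P w ≡ c → f w ≡ k → Chain (suc k) k
  chain-below k w pw fw≡k with O w ≟ c
  ... | yes ow with correct⇒chain pw ow (f w) ≤-refl
  ...   | L , fw≤|L| , desc , bounded rewrite fw≡k =
    L , fw≤|L| , desc , raise-bound (n≤1+n k) bounded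
  chain-below zero    w pw fw≡k | no ow = [] , z≤n , [] , []
  chain-below (suc k) w pw fw≡k | no ow
    with proj₂ (firstFit w) k (≤-reflexive (sym fw≡k))
  ... | u , _ , _ , pu , fu≡k with chain-below k u (trans pu pw) fu≡k
  ...   | L , k≤|L| , desc , bounded =
    w ∷ L , s≤s k≤|L| , superscripts-below fw≡k bounded ∷ desc ,
    ((pw , ow) , s≤s (≤-reflexive fw≡k)) ∷ raise-bound (n≤1+n (suc k)) bounded

  superscript≤eta : ∀ w → P w ≡ c → f w ≤ eta P O c
  superscript≤eta w pw with chain-below (f w) w pw refl
  ... | L , fw≤|L| , desc , bounded =
    ≤-trans fw≤|L| (Unique-⊆⇒length≤ (Descending⇒Unique desc) λ {v} v∈L →
      ∈-filter⁺ (λ v → (P v ≟ c) ×-dec ¬? (O v ≟ c)) (∈-allFin v) (proj₁ (All.lookup bounded v∈L)))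

  colours-used≤eta+1 : xcount P f c ≤ eta P O c + 1
  colours-used≤eta+1 =
    subst (xcount P f c ≤_) (trans (length-upTo _) (+-comm 1 _))
      (Unique-⊆⇒length≤ (deduplicate-! _≟_ (map f S)) superscript-in-range)
    where
    S : List (Fin n)
    S = filter (λ v → P v ≟ c) (vertices n)

    superscript-in-range : deduplicate _≟_ (map f S) ⊆ upTo (suc (eta P O c))
    superscript-in-range q with ∈-map⁻ f (∈-deduplicate⁻ _≟_ (map f S) q)
    ... | v , v∈S , refl =
      ∈-upTo⁺ (s≤s (superscript≤eta v (proj₂ (∈-filter⁻ (λ v → P v ≟ c) {v} {vertices n} v∈S))))

lemma1 : (n : ℕ) (G : Graph n) (π : Permutation′ n) (P : Fin n → Color)
         (O : Fin n → Color) → Optimal G O →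
         (f : Fin n → ℕ) → IsFirstFitPredictions G π P f →
         (c : Color) → xcount P f c ≤ eta P O c + 1
lemma1 n G π P O (proper , _) f firstFit c = colours-used≤eta+1 G π P O proper f firstFit c
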